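{- For every positive integer $k$, $f_1(k)\le f_2(k)$.
   Context: A $k$-CNF formula is a conjunction of clauses, each a disjunction of exactly $k$ distinct literals; a $(k,s)$-CNF formula is a $k$-CNF formula in which every variable appears in at most $s$ clauses. A CNF formula is minimal unsatisfiable if it is unsatisfiable but becomes satisfiable after deleting any one of its clauses; MU(1) denotes the class of minimal unsatisfiable CNF formulas whose number of clauses is exactly one more than the number of variables occurring in it. $f_1(k)$ is the largest integer $s$ such that no $(k,s)$-CNF formula is in MU(1). A $(k,d)$-tree is a finite rooted binary tree in which every non-leaf vertex has exactly two children and which satisfies: (i) there is no leaf at distance less than $k$ from the root, and (ii) for every vertex $v$ there are at most $d$ leaves among the descendants of $v$ at distance at most $k$ from $v$. $f_2(k)$ is the largest integer $d$ such that no $(k,d)$-tree exists. -}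

module Defs where

open import Data.Nat using (ℕ; zero; suc; _+_; _≤_; _<_)
open import Data.Nat.Properties using (_≟_)
open import Data.Bool using (Bool)
open import Data.Product using (_×_; Σ; ∃; proj₁; _,_)
open import Data.List using (List; length; filter; removeAt)
open import Data.List.Relation.Unary.Any using (Any; any?)
open import Data.List.Relation.Unary.All using (All)
open import Data.List.Relation.Unary.Unique.Propositional using (Unique)
open import Data.List.Membership.Propositional using (_∈_)
open import Data.Fin using (Fin)
open import Data.Unit using (⊤)
open import Data.Empty using (⊥)
open import Relation.Binary.PropositionalEquality using (_≡_)
open import Relation.Nullary using (¬_)
open import Function.Bundles using (_⇔_)

-- A variable is a natural number; a literal is a variable with a
-- polarity (true = positive literal x, false = negative literal ¬x).
Var : Set
Var = ℕ

Literal : Set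
Literal = Var × Bool

Clause : Set
Clause = List Literal

CNF : Set
CNF = List Clause

Assignment : Set
Assignment = Var → Bool

LitTrue : Assignment → Literal → Set
LitTrue α (x , b) = α x ≡ b

ClauseSat : Assignment → Clause → Set
ClauseSat α C = Any (LitTrue α) C

FormulaSat : Assignment → CNF → Set
FormulaSat α F = All (ClauseSat α) F

Satisfiable : CNF → Set
Satisfiable F = ∃ λ (α : Assignment) → FormulaSat α F

Unsatisfiable : CNF → Set
Unsatisfiable F = ¬ Satisfiable F

OccursIn : Var → Clause → Set
OccursIn x C = Any (λ l → proj₁ l ≡ x) C

OccursInF : Var → CNF → Set
OccursInF x F = Any (OccursIn x) F

occurrences : Var → CNF → ℕ
occurrences x F = length (filter (λ C → any? (λ l → proj₁ l ≟ x) C) F)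

IsKCNF : ℕ → CNF → Set
IsKCNF k F = All (λ C → (length C ≡ k) × Unique C) F

IsKSCNF : ℕ → ℕ → CNF → Set
IsKSCNF k s F = IsKCNF k F × (∀ (x : Var) → occurrences x F ≤ s)

NumVars : CNF → ℕ → Set
NumVars F n = Σ (List Var) λ vs →
  Unique vs × (∀ x → (x ∈ vs) ⇔ OccursInF x F) × (length vs ≡ n)

MinUnsat : CNF → Set
MinUnsat F = Unsatisfiable F × (∀ (i : Fin (length F)) → Satisfiable (removeAt F i))

InMU1 : CNF → Set
InMU1 F = MinUnsat F × (∃ λ n → NumVars F n × (length F ≡ suc n))

NoKSMU1 : ℕ → ℕ → Set
NoKSMU1 k s = ∀ (F : CNF) → IsKSCNF k s F → ¬ InMU1 F

IsF1 : ℕ → ℕ → Set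
IsF1 k s = NoKSMU1 k s × (∀ s' → s < s' → ¬ NoKSMU1 k s')

data Tree : Set where
  leaf : Tree
  node : Tree → Tree → Tree

NoLeafBefore : ℕ → Tree → Set
NoLeafBefore zero    t          = ⊤
NoLeafBefore (suc n) leaf       = ⊥
NoLeafBefore (suc n) (node l r) = NoLeafBefore n l × NoLeafBefore n r

leavesWithin : ℕ → Tree → ℕ
leavesWithin n       leaf       = 1
leavesWithin zero    (node l r) = 0
leavesWithin (suc n) (node l r) = leavesWithin n l + leavesWithin n r

EveryVertex : (Tree → Set) → Tree → Set
EveryVertex P leaf       = P leaf
EveryVertex P (node l r) = P (node l r) × EveryVertex P l × EveryVertex P r

IsKDTree : ℕ → ℕ → Tree → Set
IsKDTree k d t = NoLeafBefore k t × EveryVertex (λ v → leavesWithin k v ≤ d) t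

NoKDTree : ℕ → ℕ → Set
NoKDTree k d = ∀ (t : Tree) → ¬ IsKDTree k d t

IsF2 : ℕ → ℕ → Set
IsF2 k d = NoKDTree k d × (∀ d' → d < d' → ¬ NoKDTree k d')

-- Label the inner vertices of a (k,d)-tree by variables and give every leaf the clause
-- formed by the last k literals on its root path, where going left (right) at x contributes
-- x (¬x).  Every assignment follows one root-to-leaf path and falsifies that leaf's clause, so
-- the formula is unsatisfiable; a variable only occurs in the clauses of leaves within
-- distance k below its vertex, so it occurs at most d times.  After pruning the tree to a
-- subtree in which every child of an inner vertex has a leaf at distance less than k, each
-- variable actually occurs and every proper subformula is satisfiable, which puts the formula
-- in MU(1).  Hence a (k,d)-tree yields a (k,d)-CNF formula in MU(1), and f₁(k) ≤ f₂(k).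
module Submission where

open import Defs
open import Data.Nat using (ℕ; zero; suc; pred; _+_; _≤_; _<_; z≤n; s≤s; s≤s⁻¹; z<s; _≤?_; _<?_)
open import Data.Nat.Properties
open import Data.Bool using (Bool; true; false)
open import Data.Bool.Properties using (not-¬)
open import Data.Product using (_×_; Σ-syntax; proj₁; _,_)
open import Data.Sum using (_⊎_; inj₁; inj₂; [_,_]′)
import Data.Sum as Sum
open import Data.List using (List; []; _∷_; _++_; length; filter; removeAt; take; upTo)
open import Data.List.Properties using (length-++; filter-++; filter-reject; length-filter; length-take; length-upTo)
open import Data.List.Relation.Unary.Any using (Any; here; there; any?)
import Data.List.Relation.Unary.Any.Properties as Any
open import Data.List.Relation.Unary.All using (All; []; _∷_; lookupAny)
import Data.List.Relation.Unary.All as All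
import Data.List.Relation.Unary.All.Properties as All
open import Data.List.Relation.Unary.Unique.Propositional using (Unique)
import Data.List.Relation.Unary.Unique.Propositional.Properties as Unique
open import Data.List.Relation.Unary.AllPairs using ([]; _∷_)
open import Data.List.Relation.Binary.Sublist.Propositional.Properties using (take⁺; Any-resp-⊆; All-resp-⊆)
open import Data.List.Membership.Propositional using (_∈_)
open import Data.List.Membership.Propositional.Properties using (∈-upTo⁺; ∈-upTo⁻)
open import Data.Fin using (Fin; zero; suc)
open import Data.Unit using (⊤; tt)
open import Data.Empty using (⊥; ⊥-elim)
open import Relation.Binary.PropositionalEquality
open import Relation.Nullary using (¬_; Dec; yes; no)
open import Function using (_∘_)
open import Function.Bundles using (mk⇔)

removeAt-++ : ∀ {A : Set} (xs ys : List A) (i : Fin (length (xs ++ ys))) →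
  (Σ[ j ∈ Fin (length xs) ] removeAt (xs ++ ys) i ≡ removeAt xs j ++ ys) ⊎
  (Σ[ j ∈ Fin (length ys) ] removeAt (xs ++ ys) i ≡ xs ++ removeAt ys j)
removeAt-++ []       ys i       = inj₂ (i , refl)
removeAt-++ (x ∷ xs) ys zero    = inj₁ (zero , refl)
removeAt-++ (x ∷ xs) ys (suc i) =
  Sum.map (λ (j , eq) → suc j , cong (x ∷_) eq) (λ (j , eq) → j , cong (x ∷_) eq) (removeAt-++ xs ys i)

All-removeAt : ∀ {A : Set} {P : A → Set} {xs : List A} i → All P xs → All P (removeAt xs i)
All-removeAt zero    (px ∷ pxs) = pxs
All-removeAt (suc i) (px ∷ pxs) = px ∷ All-removeAt i pxs

m+n≤pred[m]+suc[n] : ∀ m n → m + n ≤ pred m + suc n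
m+n≤pred[m]+suc[n] zero    n = n≤1+n n
m+n≤pred[m]+suc[n] (suc m) n = ≤-reflexive (sym (+-suc m n))

occurs? : ∀ x (C : Clause) → Dec (OccursIn x C)
occurs? x C = any? (λ l → proj₁ l ≟ x) C

occurrences-++ : ∀ x F G → occurrences x (F ++ G) ≡ occurrences x F + occurrences x G
occurrences-++ x F G = trans (cong length (filter-++ (occurs? x) F G)) (length-++ (filter (occurs? x) F))

VarsBelow : ℕ → Clause → Set
VarsBelow n C = All (λ l → proj₁ l < n) C

VarsBelow-∷ : ∀ {m n b p} → m < n → VarsBelow m p → VarsBelow n ((m , b) ∷ p)
VarsBelow-∷ m<n vs = m<n ∷ All.map (λ lt → <-trans lt m<n) vs

Agree : ℕ → Assignment → Assignment → Set
Agree n α β = ∀ x → x < n → α x ≡ β x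

agree-refl : ∀ {n α} → Agree n α α
agree-refl _ _ = refl

agree-trans : ∀ {n α β γ} → Agree n α β → Agree n β γ → Agree n α γ
agree-trans α≈β β≈γ x lt = trans (α≈β x lt) (β≈γ x lt)

agree-weaken : ∀ {m n α β} → m ≤ n → Agree n α β → Agree m α β
agree-weaken m≤n α≈β x lt = α≈β x (≤-trans lt m≤n)

clauseSat-transfer : ∀ {n α β C} → VarsBelow n C → Agree n α β → ClauseSat α C → ClauseSat β C
clauseSat-transfer (lt ∷ _)  α≈β (here αl)  = here (trans (sym (α≈β _ lt)) αl)
clauseSat-transfer (_ ∷ lts) α≈β (there αC) = there (clauseSat-transfer lts α≈β αC)

formulaSat-transfer : ∀ {n α β F} → All (VarsBelow n) F → Agree n α β → FormulaSat α F → FormulaSat β F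
formulaSat-transfer vars α≈β = All.zipWith (λ (vs , αC) → clauseSat-transfer vs α≈β αC) ∘ (vars ,_)

set : Assignment → Var → Bool → Assignment
set α x c y with y ≟ x
... | yes _ = c
... | no  _ = α y

set-self : ∀ β x c → set β x c x ≡ c
set-self β x c with x ≟ x
... | yes _  = refl
... | no x≢x = ⊥-elim (x≢x refl)

agree-set : ∀ β x c → Agree x β (set β x c)
agree-set β x c y y<x with y ≟ x
... | yes refl = ⊥-elim (<-irrefl refl y<x)
... | no  _    = refl

agree-set⇒≡ : ∀ {α β x c} → Agree (suc x) (set β x c) α → α x ≡ c
agree-set⇒≡ {β = β} {x} {c} agree = trans (sym (agree x ≤-refl)) (set-self β x c)

agree-set⇒agree : ∀ {α β x c} → Agree (suc x) (set β x c) α → Agree x β α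
agree-set⇒agree {β = β} {x} {c} agree = agree-trans (agree-set β x c) (agree-weaken (n≤1+n x) agree)

SatisfiableAbove : ℕ → Assignment → CNF → Set
SatisfiableAbove n β F = Σ[ α ∈ Assignment ] Agree n β α × FormulaSat α F

satisfiableAbove-++ : ∀ {m n β F G} → n ≤ m → All (VarsBelow m) F → SatisfiableAbove n β F →
  (∀ {α} → Agree n β α → SatisfiableAbove m α G) → SatisfiableAbove n β (F ++ G)
satisfiableAbove-++ n≤m vars (α , β≈α , αF) satisfyG with satisfyG β≈α
... | γ , α≈γ , γG =
  γ , agree-trans β≈α (agree-weaken n≤m α≈γ) , All.++⁺ (formulaSat-transfer vars α≈γ αF) γG

satisfiableAbove-branch : ∀ {β o m L R} c → suc o ≤ m → All (VarsBelow m) L →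
  SatisfiableAbove (suc o) (set β o c) L →
  (∀ {α} → α o ≡ c → Agree o β α → SatisfiableAbove m α R) →
  SatisfiableAbove o β (L ++ R)
satisfiableAbove-branch c o<m vars satL satR
  with satisfiableAbove-++ o<m vars satL (λ agree → satR (agree-set⇒≡ agree) (agree-set⇒agree agree))
... | α , agree , αLR = α , agree-set⇒agree agree , αLR

innerCount : Tree → ℕ
innerCount leaf       = 0
innerCount (node l r) = suc (innerCount l + innerCount r)

LeafBefore : ℕ → Tree → Set
LeafBefore zero    t          = ⊥
LeafBefore (suc n) leaf       = ⊤
LeafBefore (suc n) (node l r) = LeafBefore n l ⊎ LeafBefore n r

noLeafBefore⊎leafBefore : ∀ n t → NoLeafBefore n t ⊎ LeafBefore n t
noLeafBefore⊎leafBefore zero    t          = inj₁ tt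
noLeafBefore⊎leafBefore (suc n) leaf       = inj₂ tt
noLeafBefore⊎leafBefore (suc n) (node l r) with noLeafBefore⊎leafBefore n l | noLeafBefore⊎leafBefore n r
... | inj₁ nl | inj₁ nr = inj₁ (nl , nr)
... | inj₂ ll | _       = inj₂ (inj₁ ll)
... | inj₁ _  | inj₂ lr = inj₂ (inj₂ lr)

leafBefore⇒¬noLeafBefore : ∀ n t → LeafBefore n t → ¬ NoLeafBefore n t
leafBefore⇒¬noLeafBefore (suc n) (node l r) (inj₁ ll) (nl , _) = leafBefore⇒¬noLeafBefore n l ll nl
leafBefore⇒¬noLeafBefore (suc n) (node l r) (inj₂ lr) (_ , nr) = leafBefore⇒¬noLeafBefore n r lr nr

noLeafBefore-children : ∀ n l r → NoLeafBefore n (node l r) → NoLeafBefore (pred n) l × NoLeafBefore (pred n) r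
noLeafBefore-children zero    l r _ = tt , tt
noLeafBefore-children (suc n) l r h = h

leavesBefore : ℕ → Tree → ℕ
leavesBefore zero    t = 0
leavesBefore (suc n) t = leavesWithin n t

leavesBefore-node : ∀ n l r → leavesBefore n (node l r) ≡ leavesBefore (pred n) l + leavesBefore (pred n) r
leavesBefore-node zero          l r = refl
leavesBefore-node (suc zero)    l r = refl
leavesBefore-node (suc (suc n)) l r = refl

everyVertex-root : ∀ {P : Tree → Set} t → EveryVertex P t → P t
everyVertex-root leaf       p           = p
everyVertex-root (node l r) (p , _ , _) = p

ChildrenLeafBefore : ℕ → Tree → Set
ChildrenLeafBefore n leaf       = ⊤
ChildrenLeafBefore n (node l r) = LeafBefore n l × LeafBefore n r

Pruned : ℕ → Tree → Set
Pruned k = EveryVertex (ChildrenLeafBefore k)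

pruned-node : ∀ k l r → EveryVertex (LeafBefore k) l → EveryVertex (LeafBefore k) r → Pruned k (node l r)

pruned-everyVertex : ∀ k t → EveryVertex (LeafBefore k) t → Pruned k t
pruned-everyVertex k leaf       _             = tt
pruned-everyVertex k (node l r) (_ , el , er) = pruned-node k l r el er

pruned-node k l r el er =
  (everyVertex-root l el , everyVertex-root r er) , pruned-everyVertex k l el , pruned-everyVertex k r er

-- A lowest vertex without a leaf at distance less than k roots a pruned subtree.
pruned-subtree : ∀ k {P : Tree → Set} t → EveryVertex P t →
  (Σ[ t′ ∈ Tree ] NoLeafBefore k t′ × EveryVertex P t′ × Pruned k t′) ⊎ EveryVertex (LeafBefore k) t
pruned-subtree k leaf p with noLeafBefore⊎leafBefore k leaf
... | inj₁ nlb = inj₁ (leaf , nlb , p , tt)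
... | inj₂ lb  = inj₂ lb
pruned-subtree k (node l r) ev@(p , evl , evr) with pruned-subtree k l evl | pruned-subtree k r evr
... | inj₁ sub | _        = inj₁ sub
... | inj₂ _   | inj₁ sub = inj₁ sub
... | inj₂ el  | inj₂ er  with noLeafBefore⊎leafBefore k (node l r)
...   | inj₁ nlb = inj₁ (node l r , nlb , ev , pruned-node k l r el er)
...   | inj₂ lb  = inj₂ (lb , el , er)

kdTree⇒prunedKDTree : ∀ k d t → IsKDTree k d t → Σ[ t′ ∈ Tree ] IsKDTree k d t′ × Pruned k t′
kdTree⇒prunedKDTree k d t (nlb , ev) with pruned-subtree k t ev
... | inj₁ (t′ , nlb′ , ev′ , pruned) = t′ , (nlb′ , ev′) , pruned
... | inj₂ near = ⊥-elim (leafBefore⇒¬noLeafBefore k t (everyVertex-root t near) nlb)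

module Construction (k : ℕ) where

  -- Variables o, o+1, … label the inner vertices of t in preorder; p is the path from the
  -- root of the whole tree down to t, most recent literal first.
  clauses : Tree → Var → List Literal → CNF
  clauses leaf       o p = take k p ∷ []
  clauses (node l r) o p = clauses l (suc o) ((o , true) ∷ p) ++ clauses r (suc o + innerCount l) ((o , false) ∷ p)

  formula : Tree → CNF
  formula t = clauses t 0 []

  right-label : ∀ o l → o < suc o + innerCount l
  right-label o l = s≤s (m≤m+n o (innerCount l))

  right-end : ∀ o l r → suc o + innerCount l + innerCount r ≡ o + innerCount (node l r)
  right-end o l r = trans (cong suc (+-assoc o (innerCount l) (innerCount r))) (sym (+-suc o _))

  left-end : ∀ o l r → suc o + innerCount l ≤ o + innerCount (node l r)
  left-end o l r = ≤-trans (m≤m+n _ (innerCount r)) (≤-reflexive (right-end o l r))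

  empty-label-range : ∀ {x o} → o ≤ x → ¬ x < o + innerCount leaf
  empty-label-range {x} {o} o≤x x<o+0 = <⇒≱ (subst (x <_) (+-identityʳ o) x<o+0) o≤x

  label-cases : ∀ {x o} l r → o ≤ x → x < o + innerCount (node l r) →
    x ≡ o ⊎ (o < x × x < suc o + innerCount l) ⊎
    (suc o + innerCount l ≤ x × x < suc o + innerCount l + innerCount r)
  label-cases {x} {o} l r o≤x x<end with x ≟ o | x <? suc o + innerCount l
  ... | yes x≡o | _       = inj₁ x≡o
  ... | no  x≢o | yes x<m = inj₂ (inj₁ (≤∧≢⇒< o≤x (x≢o ∘ sym) , x<m))
  ... | no  _   | no  x≮m = inj₂ (inj₂ (≮⇒≥ x≮m , subst (x <_) (sym (right-end o l r)) x<end))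

  length-clauses : ∀ t o p → length (clauses t o p) ≡ suc (innerCount t)
  length-clauses leaf       o p = refl
  length-clauses (node l r) o p = begin
    length (clauses l _ _ ++ clauses r _ _)          ≡⟨ length-++ (clauses l _ _) ⟩
    length (clauses l _ _) + length (clauses r _ _)  ≡⟨ cong₂ _+_ (length-clauses l _ _) (length-clauses r _ _) ⟩
    suc (innerCount l) + suc (innerCount r)          ≡⟨ cong suc (+-suc (innerCount l) (innerCount r)) ⟩
    suc (innerCount (node l r))                      ∎
    where open ≡-Reasoning

  clauses-varsBelow : ∀ t o p → VarsBelow o p → All (VarsBelow (o + innerCount t)) (clauses t o p)
  clauses-varsBelow leaf       o p vs = All.take⁺ k (subst (λ n → VarsBelow n p) (sym (+-identityʳ o)) vs) ∷ []
  clauses-varsBelow (node l r) o p vs = All.++⁺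
    (All.map (All.map (λ lt → ≤-trans lt (left-end o l r)))
      (clauses-varsBelow l (suc o) _ (VarsBelow-∷ ≤-refl vs)))
    (subst (λ n → All (VarsBelow n) (clauses r (suc o + innerCount l) ((o , false) ∷ p))) (right-end o l r)
      (clauses-varsBelow r (suc o + innerCount l) _ (VarsBelow-∷ (right-label o l) vs)))

  unique-∷ : ∀ {o b p} → VarsBelow o p → Unique p → Unique ((o , b) ∷ p)
  unique-∷ vs u = All.map (λ lt eq → <⇒≢ lt (cong proj₁ (sym eq))) vs ∷ u

  clauses-kcnf : ∀ t o p n → NoLeafBefore n t → k ≤ n + length p → Unique p → VarsBelow o p →
    IsKCNF k (clauses t o p)
  clauses-kcnf leaf o p zero _ k≤len u vs =
    (trans (length-take k p) (m≤n⇒m⊓n≡m k≤len) , Unique.take⁺ k u) ∷ []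
  clauses-kcnf (node l r) o p n nlb k≤ u vs with noLeafBefore-children n l r nlb
  ... | nl , nr = All.++⁺
    (clauses-kcnf l (suc o) _ (pred n) nl k≤′ (unique-∷ vs u) (VarsBelow-∷ ≤-refl vs))
    (clauses-kcnf r (suc o + innerCount l) _ (pred n) nr k≤′ (unique-∷ vs u) (VarsBelow-∷ (right-label o l) vs))
    where
    k≤′ : k ≤ pred n + suc (length p)
    k≤′ = ≤-trans k≤ (m+n≤pred[m]+suc[n] n (length p))

  OutsideLabels : Var → Var → Tree → Set
  OutsideLabels x o t = x < o ⊎ o + innerCount t ≤ x

  occurrences-node-≤ : ∀ x o p l r {a b} →
    occurrences x (clauses l (suc o) ((o , true) ∷ p)) ≤ a →
    occurrences x (clauses r (suc o + innerCount l) ((o , false) ∷ p)) ≤ b →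
    occurrences x (clauses (node l r) o p) ≤ a + b
  occurrences-node-≤ x o p l r occˡ occʳ =
    ≤-trans (≤-reflexive (occurrences-++ x (clauses l (suc o) ((o , true) ∷ p)) _)) (+-mono-≤ occˡ occʳ)

  varsBelow⇒take-≢ : ∀ {x} m q → VarsBelow x q → All (λ l → proj₁ l ≢ x) (take m q)
  varsBelow⇒take-≢ m q vs = All.take⁺ m (All.map <⇒≢ vs)

  -- A leaf at depth j gets take k (path), whose part coming from p is take (k ∸ j) p; so a
  -- variable missing from take m p and from the labels of t occurs only at depths j < k ∸ m.
  occurrences-outside : ∀ x t o p m n → OutsideLabels x o t → All (λ l → proj₁ l ≢ x) (take m p) →
    k ≤ n + m → occurrences x (clauses t o p) ≤ leavesBefore n t
  occurrences-outside x leaf o p m zero _ x∉p k≤m =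
    ≤-reflexive (cong length (filter-reject (occurs? x) (All.All¬⇒¬Any (All-resp-⊆ (take⁺ k≤m) x∉p))))
  occurrences-outside x leaf o p m (suc n) _ _ _ = length-filter (occurs? x) (take k p ∷ [])
  occurrences-outside x (node l r) o p m n out x∉p k≤ =
    subst (occurrences x (clauses (node l r) o p) ≤_) (sym (leavesBefore-node n l r)) (occurrences-node-≤ x o p l r
      (occurrences-outside x l (suc o) _ (suc m) (pred n) outˡ (o≢x ∷ x∉p) k≤′)
      (occurrences-outside x r (suc o + innerCount l) _ (suc m) (pred n) outʳ (o≢x ∷ x∉p) k≤′))
    where
    o≢x : o ≢ x
    o≢x = [ >⇒≢ , (λ end≤x → <⇒≢ (<-≤-trans (m<m+n o z<s) end≤x)) ]′ out
    outˡ : OutsideLabels x (suc o) l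
    outˡ = Sum.map m<n⇒m<1+n (≤-trans (left-end o l r)) out
    outʳ : OutsideLabels x (suc o + innerCount l) r
    outʳ = Sum.map (λ x<o → <-trans x<o (right-label o l)) (≤-trans (≤-reflexive (right-end o l r))) out
    k≤′ : k ≤ pred n + suc m
    k≤′ = ≤-trans k≤ (m+n≤pred[m]+suc[n] n m)

  occurrences-label : ∀ d x t o p → VarsBelow o p → o ≤ x → x < o + innerCount t →
    EveryVertex (λ v → leavesWithin k v ≤ d) t → occurrences x (clauses t o p) ≤ d
  occurrences-label d x leaf o p _ o≤x x<o+0 _ = ⊥-elim (empty-label-range o≤x x<o+0)
  occurrences-label d x (node l r) o p vs o≤x x<end (dv , evl , evr) with label-cases l r o≤x x<end
  ... | inj₁ refl = ≤-trans
    (occurrences-node-≤ x o p l r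
      (occurrences-outside x l (suc o) _ 0 k (inj₁ ≤-refl) [] (m≤m+n k 0))
      (occurrences-outside x r (suc o + innerCount l) _ 0 k (inj₁ (right-label o l)) [] (m≤m+n k 0)))
    (subst (_≤ d) (leavesBefore-node (suc k) l r) dv)
  ... | inj₂ (inj₁ (o<x , x<m)) = ≤-trans
    (occurrences-node-≤ x o p l r
      (occurrences-label d x l (suc o) _ (VarsBelow-∷ ≤-refl vs) o<x x<m evl)
      (occurrences-outside x r (suc o + innerCount l) _ k 0 (inj₁ x<m)
        (varsBelow⇒take-≢ k _ (VarsBelow-∷ o<x vs)) ≤-refl))
    (≤-reflexive (+-identityʳ d))
  ... | inj₂ (inj₂ (m≤x , x<end′)) = occurrences-node-≤ x o p l r
    (occurrences-outside x l (suc o) _ k 0 (inj₂ m≤x)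
      (varsBelow⇒take-≢ k _ (VarsBelow-∷ (<-≤-trans (right-label o l) m≤x) vs)) ≤-refl)
    (occurrences-label d x r (suc o + innerCount l) _ (VarsBelow-∷ (right-label o l) vs) m≤x x<end′ evr)

  occurrences-formula : ∀ d t → EveryVertex (λ v → leavesWithin k v ≤ d) t →
    ∀ x → occurrences x (formula t) ≤ d
  occurrences-formula d t ev x with x <? innerCount t
  ... | yes x<n = occurrences-label d x t 0 [] [] z≤n x<n ev
  ... | no  x≮n =
    ≤-trans (occurrences-outside x t 0 [] k 0 (inj₂ (≮⇒≥ x≮n)) (All.take⁺ k []) ≤-refl) z≤n

  k+1≤1+k : k + 1 ≤ suc k
  k+1≤1+k = ≤-reflexive (+-comm k 1)

  descend : ∀ {n m} → suc n + m ≤ suc k → n + suc m ≤ suc k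
  descend {n} {m} le = ≤-trans (≤-reflexive (+-suc n m)) le

  leaf-take : ∀ {n m} → suc n + m ≤ suc k → m ≤ k
  leaf-take {n} {m} le = ≤-trans (m≤n+m m n) (s≤s⁻¹ le)

  -- A leaf at depth j < n lies below t, and its clause keeps the first k ∸ j ≥ m literals of p.
  clauses-reach : ∀ {P : Literal → Set} t o p n m → LeafBefore n t → n + m ≤ suc k →
    Any P (take m p) → Any (Any P) (clauses t o p)
  clauses-reach leaf       o p (suc n) m _         le h = here (Any-resp-⊆ (take⁺ (leaf-take le)) h)
  clauses-reach (node l r) o p (suc n) m (inj₁ ll) le h =
    Any.++⁺ˡ (clauses-reach l (suc o) _ n (suc m) ll (descend le) (there h))
  clauses-reach (node l r) o p (suc n) m (inj₂ lr) le h =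
    Any.++⁺ʳ (clauses l (suc o) ((o , true) ∷ p))
      (clauses-reach r (suc o + innerCount l) _ n (suc m) lr (descend le) (there h))

  clauses-cover : ∀ x t o p → Pruned k t → o ≤ x → x < o + innerCount t → OccursInF x (clauses t o p)
  clauses-cover x leaf o p _ o≤x x<o+0 = ⊥-elim (empty-label-range o≤x x<o+0)
  clauses-cover x (node l r) o p ((ll , _) , prunedˡ , prunedʳ) o≤x x<end with label-cases l r o≤x x<end
  ... | inj₁ refl = Any.++⁺ˡ (clauses-reach l (suc o) ((o , true) ∷ p) k 1 ll k+1≤1+k (here refl))
  ... | inj₂ (inj₁ (o<x , x<m)) = Any.++⁺ˡ (clauses-cover x l (suc o) _ prunedˡ o<x x<m)
  ... | inj₂ (inj₂ (m≤x , x<end′)) =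
    Any.++⁺ʳ (clauses l (suc o) ((o , true) ∷ p))
      (clauses-cover x r (suc o + innerCount l) _ prunedʳ m≤x x<end′)

  Falsified : Assignment → Clause → Set
  Falsified α C = All (λ l → ¬ LitTrue α l) C

  clauses-falsified : ∀ α t o p → Falsified α p → Any (Falsified α) (clauses t o p)
  clauses-falsified α leaf       o p h = here (All.take⁺ k h)
  clauses-falsified α (node l r) o p h with α o in αo
  ... | true  = Any.++⁺ʳ (clauses l (suc o) ((o , true) ∷ p)) (clauses-falsified α r _ _ (not-¬ αo ∷ h))
  ... | false = Any.++⁺ˡ (clauses-falsified α l _ _ (not-¬ αo ∷ h))

  formula-unsatisfiable : ∀ t → Unsatisfiable (formula t)
  formula-unsatisfiable t (α , αF) with lookupAny αF (clauses-falsified α t 0 [] [])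
  ... | αC , falsified = All.All¬⇒¬Any falsified αC

  -- Each vertex sets its variable to satisfy the literal towards the child away from the near
  -- leaf, which again has a leaf at distance less than k; on the side of the near leaf the
  -- hypothesis literal stays within the last k literals.
  clauses-satisfiableAbove : ∀ β t o p n m → Pruned k t → LeafBefore n t → n + m ≤ suc k → VarsBelow o p →
    Any (LitTrue β) (take m p) → SatisfiableAbove o β (clauses t o p)

  clauses-satisfiableAbove-head : ∀ α t o o′ c p → Pruned k t → LeafBefore k t → o < o′ → VarsBelow o p →
    α o ≡ c → SatisfiableAbove o′ α (clauses t o′ ((o , c) ∷ p))
  clauses-satisfiableAbove-head α t o o′ c p pruned lb o<o′ vs αo =
    clauses-satisfiableAbove α t o′ _ k 1 pruned lb k+1≤1+k (VarsBelow-∷ o<o′ vs) (here αo)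

  clauses-satisfiableAbove β leaf o p (suc n) m _ _ le _ h =
    β , agree-refl , (Any-resp-⊆ (take⁺ (leaf-take le)) h ∷ [])
  clauses-satisfiableAbove β (node l r) o p (suc n) m ((_ , lr) , prunedˡ , prunedʳ) (inj₁ ll′) le vs h =
    satisfiableAbove-branch false (m≤m+n _ _) (clauses-varsBelow l (suc o) _ (VarsBelow-∷ ≤-refl vs))
      (clauses-satisfiableAbove (set β o false) l (suc o) _ n (suc m) prunedˡ ll′ (descend le)
        (VarsBelow-∷ ≤-refl vs)
        (there (clauseSat-transfer (All.take⁺ m vs) (agree-set β o false) h)))
      (λ αo _ → clauses-satisfiableAbove-head _ r o _ false p prunedʳ lr (right-label o l) vs αo)
  clauses-satisfiableAbove β (node l r) o p (suc n) m ((ll , _) , prunedˡ , prunedʳ) (inj₂ lr′) le vs h =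
    satisfiableAbove-branch true (m≤m+n _ _) (clauses-varsBelow l (suc o) _ (VarsBelow-∷ ≤-refl vs))
      (clauses-satisfiableAbove-head (set β o true) l o (suc o) true p prunedˡ ll ≤-refl vs (set-self β o true))
      (λ _ β≈α → clauses-satisfiableAbove _ r (suc o + innerCount l) _ n (suc m) prunedʳ lr′ (descend le)
        (VarsBelow-∷ (right-label o l) vs) (there (clauseSat-transfer (All.take⁺ m vs) β≈α h)))

  removeAt-clauses-satisfiableAbove : ∀ β t o p → Pruned k t → VarsBelow o p →
    (i : Fin (length (clauses t o p))) → SatisfiableAbove o β (removeAt (clauses t o p) i)
  removeAt-clauses-satisfiableAbove β leaf o p _ _ zero = β , agree-refl , []
  removeAt-clauses-satisfiableAbove β (node l r) o p ((ll , lr) , prunedˡ , prunedʳ) vs i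
    with removeAt-++ (clauses l (suc o) ((o , true) ∷ p)) (clauses r (suc o + innerCount l) ((o , false) ∷ p)) i
  ... | inj₁ (j , eq) = subst (SatisfiableAbove o β) (sym eq)
    (satisfiableAbove-branch false (m≤m+n _ _)
      (All-removeAt j (clauses-varsBelow l (suc o) _ (VarsBelow-∷ ≤-refl vs)))
      (removeAt-clauses-satisfiableAbove (set β o false) l (suc o) _ prunedˡ (VarsBelow-∷ ≤-refl vs) j)
      (λ αo _ → clauses-satisfiableAbove-head _ r o _ false p prunedʳ lr (right-label o l) vs αo))
  ... | inj₂ (j , eq) = subst (SatisfiableAbove o β) (sym eq)
    (satisfiableAbove-branch true (m≤m+n _ _) (clauses-varsBelow l (suc o) _ (VarsBelow-∷ ≤-refl vs))
      (clauses-satisfiableAbove-head (set β o true) l o (suc o) true p prunedˡ ll ≤-refl vs (set-self β o true))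
      (λ _ _ → removeAt-clauses-satisfiableAbove _ r (suc o + innerCount l) _ prunedʳ
        (VarsBelow-∷ (right-label o l) vs) j))

  formula-minUnsat : ∀ t → Pruned k t → MinUnsat (formula t)
  formula-minUnsat t pruned = formula-unsatisfiable t , λ i →
    let α , _ , αF = removeAt-clauses-satisfiableAbove (λ _ → true) t 0 [] pruned [] i in α , αF

  formula-numVars : ∀ t → Pruned k t → NumVars (formula t) (innerCount t)
  formula-numVars t pruned =
    upTo (innerCount t) , Unique.upTo⁺ (innerCount t) , (λ x → mk⇔ (label⇒occurs x) (occurs⇒label x)) ,
    length-upTo (innerCount t)
    where
    label⇒occurs : ∀ x → x ∈ upTo (innerCount t) → OccursInF x (formula t)
    label⇒occurs x x∈ = clauses-cover x t 0 [] pruned z≤n (∈-upTo⁻ x∈)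
    occurs⇒label : ∀ x → OccursInF x (formula t) → x ∈ upTo (innerCount t)
    occurs⇒label x occ with lookupAny (clauses-varsBelow t 0 [] []) occ
    ... | vs , occC with lookupAny vs occC
    ...   | lt , eq = ∈-upTo⁺ (subst (_< innerCount t) eq lt)

  formula-MU1 : ∀ d t → IsKDTree k d t → Pruned k t → IsKSCNF k d (formula t) × InMU1 (formula t)
  formula-MU1 d t (nlb , ev) pruned =
    (clauses-kcnf t 0 [] k nlb (m≤m+n k 0) [] [] , occurrences-formula d t ev) ,
    formula-minUnsat t pruned , innerCount t , formula-numVars t pruned , length-clauses t 0 []

noKSMU1⇒noKDTree : ∀ k d → NoKSMU1 k d → NoKDTree k d
noKSMU1⇒noKDTree k d noFormula t isTree with kdTree⇒prunedKDTree k d t isTree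
... | t′ , isTree′ , pruned =
  let isKS , mu1 = Construction.formula-MU1 k d t′ isTree′ pruned in noFormula _ isKS mu1

noKSMU1-antimono : ∀ {k s s′} → s ≤ s′ → NoKSMU1 k s′ → NoKSMU1 k s
noKSMU1-antimono s≤s′ noFormula F (isK , occ) = noFormula F (isK , λ x → ≤-trans (occ x) s≤s′)

-- The construction works for every k.
lemma3 : ∀ (k : ℕ) → 1 ≤ k → ∀ (s d : ℕ) → IsF1 k s → IsF2 k d → s ≤ d
lemma3 k _ s d (noFormula , _) (_ , dMaximal) with s ≤? d
... | yes s≤d = s≤d
... | no  s≰d =
  ⊥-elim (dMaximal (suc d) ≤-refl (noKSMU1⇒noKDTree k (suc d) (noKSMU1-antimono (≰⇒> s≰d) noFormula)))
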